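{- Let $a>1$, $b>1$, $c>0$, $r>0$, $s>0$ be integers with $\gcd(ra,sb)=1$, and suppose the equation $(-1)^u r a^x + (-1)^v s b^y = c$ has two solutions $(x_1,y_1,u_1,v_1)$ and $(x_2,y_2,u_2,v_2)$ (nonnegative integers $x_i,y_i$, $u_i,v_i\in\{0,1\}$) with $x_1=0$ and $x_2>0$. Then, if $a$ is even, $r$ is even. -}

module Defs where

open import Data.Nat using (ℕ)
open import Data.Fin using (Fin; zero; suc)
open import Data.Integer using (ℤ; +_; -_; _+_; _*_; _^_)
open import Relation.Binary.PropositionalEquality using (_≡_)

sgn : Fin 2 → ℤ
sgn zero = + 1
sgn (suc zero) = - (+ 1)

IsSolution : (a b c r s : ℕ) → ℕ → ℕ → Fin 2 → Fin 2 → Set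
IsSolution a b c r s x y u v =
  sgn u * (+ r) * (+ a) ^ x + sgn v * (+ s) * (+ b) ^ y ≡ + c

{-# OPTIONS --safe #-}
module Submission where

-- If r were odd then, since gcd(ra, sb) = 1 and a is even, s and b are odd too.  The
-- solution with x = 0 then writes c as a sum of two odd terms, so c is even, while the
-- solution with x > 0 writes c as an even term plus an odd one, so c is odd.

open import Defs
open import Data.Nat using (ℕ; _<_; _*_)
open import Data.Nat.Divisibility using (_∣_)
open import Data.Nat.GCD using (gcd)
open import Data.Fin using (Fin)
open import Relation.Binary.PropositionalEquality using (_≡_)

open import Data.Nat using (zero; suc; s≤s)
open import Data.Nat.Coprimality using (gcd≡1⇒coprime)
open import Data.Nat.Divisibility using (_∣?_; ∣1⇒≡1; ∣m⇒∣m*n; ∣n⇒∣m*n)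
open import Data.Nat.Primality using (Prime; prime[2]; euclidsLemma; ¬prime[1])
import Data.Integer as ℤ
open import Data.Integer using (ℤ; +_; _+_; _^_; 1ℤ)
import Data.Integer.Divisibility.Signed as ℤ
open import Data.Integer.DivMod using (_%_; _/_; n%d<d; a≡a%n+[a/n]*n)
open import Data.Integer.Properties using (abs-*; +-comm; +-identityˡ)
open import Data.Integer.Tactic.RingSolver using (solve-∀)
open import Data.Product using (∃; _,_)
open import Data.Sum using ([_,_])
open import Function using (_∘_)
open import Data.Fin using (zero; suc)
open import Relation.Nullary using (¬_; yes; no; contradiction)
open import Relation.Binary.PropositionalEquality using (refl; sym; trans; subst)

module _ {p : ℕ} (prime : Prime p) where

  ∤1 : ¬ + p ℤ.∣ 1ℤ
  ∤1 p∣1 = ¬prime[1] (subst Prime (∣1⇒≡1 (ℤ.∣⇒∣ᵤ p∣1)) prime)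

  ∤*∤⇒∤ : ∀ {i j} → ¬ + p ℤ.∣ i → ¬ + p ℤ.∣ j → ¬ + p ℤ.∣ i ℤ.* j
  ∤*∤⇒∤ {i} {j} p∤i p∤j p∣ij =
    [ p∤i ∘ ℤ.∣ᵤ⇒∣ , p∤j ∘ ℤ.∣ᵤ⇒∣ ]
      (euclidsLemma ℤ.∣ i ∣ ℤ.∣ j ∣ prime (subst (p ∣_) (abs-* i j) (ℤ.∣⇒∣ᵤ p∣ij)))

  ∤⇒∤^ : ∀ {i} n → ¬ + p ℤ.∣ i → ¬ + p ℤ.∣ i ^ n
  ∤⇒∤^ zero    _   = ∤1
  ∤⇒∤^ (suc n) p∤i = ∤*∤⇒∤ p∤i (∤⇒∤^ n p∤i)

  ∤-sgn : ∀ u → ¬ + p ℤ.∣ sgn u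
  ∤-sgn zero       = ∤1
  ∤-sgn (suc zero) = ∤1 ∘ ℤ.∣m⇒∣-m

  ∤-signedTerm : ∀ u {t w} → ¬ + p ℤ.∣ t → ¬ + p ℤ.∣ w → ¬ + p ℤ.∣ sgn u ℤ.* t ℤ.* w
  ∤-signedTerm u p∤t p∤w = ∤*∤⇒∤ (∤*∤⇒∤ (∤-sgn u) p∤t) p∤w

∤⇒∤ᶻ : ∀ {d n} → ¬ d ∣ n → ¬ + d ℤ.∣ + n
∤⇒∤ᶻ d∤n = d∤n ∘ ℤ.∣⇒∣ᵤ

2∤⇒≡k*2+1 : ∀ {i} → ¬ + 2 ℤ.∣ i → ∃ λ k → i ≡ k ℤ.* + 2 + 1ℤ
2∤⇒≡k*2+1 {i} 2∤i with i % + 2 | n%d<d i (+ 2) | a≡a%n+[a/n]*n i (+ 2)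
... | 0 | _ | i≡ = contradiction (ℤ.divides (i / + 2) (trans i≡ (+-identityˡ ((i / + 2) ℤ.* + 2)))) 2∤i
... | 1 | _ | i≡ = i / + 2 , trans i≡ (+-comm 1ℤ ((i / + 2) ℤ.* + 2))
... | suc (suc _) | s≤s (s≤s ()) | _

2∣odd+odd : ∀ {i j} → ¬ + 2 ℤ.∣ i → ¬ + 2 ℤ.∣ j → + 2 ℤ.∣ i + j
2∣odd+odd 2∤i 2∤j with 2∤⇒≡k*2+1 2∤i | 2∤⇒≡k*2+1 2∤j
... | k , refl | l , refl = ℤ.divides (k + l + 1ℤ) (sum-of-odds k l)
  where
  sum-of-odds : ∀ k l → k ℤ.* + 2 + 1ℤ + (l ℤ.* + 2 + 1ℤ) ≡ (k + l + 1ℤ) ℤ.* + 2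
  sum-of-odds = solve-∀

module SolutionParity (a b c r s : ℕ) (2∤s : ¬ 2 ∣ s) (2∤b : ¬ 2 ∣ b) where

  solution-x≡0⇒2∣c : ∀ y u v → IsSolution a b c r s 0 y u v → ¬ 2 ∣ r → 2 ∣ c
  solution-x≡0⇒2∣c y u v sol 2∤r = ℤ.∣⇒∣ᵤ (subst (+ 2 ℤ.∣_) sol
    (2∣odd+odd (∤-signedTerm prime[2] u (∤⇒∤ᶻ 2∤r) (∤1 prime[2]))
             (∤-signedTerm prime[2] v (∤⇒∤ᶻ 2∤s) (∤⇒∤^ prime[2] y (∤⇒∤ᶻ 2∤b)))))

  solution-x>0⇒2∤c : ∀ x y u v → IsSolution a b c r s (suc x) y u v → 2 ∣ a → ¬ 2 ∣ c
  solution-x>0⇒2∤c x y u v sol 2∣a 2∣c =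
    ∤-signedTerm prime[2] v (∤⇒∤ᶻ 2∤s) (∤⇒∤^ prime[2] y (∤⇒∤ᶻ 2∤b))
      (ℤ.∣m+n∣m⇒∣n (subst (+ 2 ℤ.∣_) (sym sol) (ℤ.∣ᵤ⇒∣ 2∣c)) 2∣ra^x)
    where
    2∣ra^x : + 2 ℤ.∣ sgn u ℤ.* + r ℤ.* (+ a) ^ suc x
    2∣ra^x = ℤ.∣n⇒∣m*n (sgn u ℤ.* + r) (ℤ.∣m⇒∣m*n ((+ a) ^ x) (ℤ.∣ᵤ⇒∣ {+ 2} {+ a} 2∣a))

lemma5 : (a b c r s : ℕ) → 1 < a → 1 < b → 0 < c → 0 < r → 0 < s →
         gcd (r * a) (s * b) ≡ 1 →
         (x₁ y₁ : ℕ) (u₁ v₁ : Fin 2) (x₂ y₂ : ℕ) (u₂ v₂ : Fin 2) →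
         IsSolution a b c r s x₁ y₁ u₁ v₁ →
         IsSolution a b c r s x₂ y₂ u₂ v₂ →
         x₁ ≡ 0 → 0 < x₂ →
         2 ∣ a → 2 ∣ r
lemma5 a b c r s _ _ _ _ _ gcd≡1 x₁ y₁ u₁ v₁ (suc x₂) y₂ u₂ v₂ sol₁ sol₂ refl _ 2∣a
  with 2 ∣? r
... | yes 2∣r = 2∣r
... | no 2∤r  = contradiction (solution-x≡0⇒2∣c y₁ u₁ v₁ sol₁ 2∤r)
                              (solution-x>0⇒2∤c x₂ y₂ u₂ v₂ sol₂ 2∣a)
  where
  2∤sb : ¬ 2 ∣ s * b
  2∤sb 2∣sb = contradiction (gcd≡1⇒coprime gcd≡1 (∣n⇒∣m*n r 2∣a , 2∣sb)) λ ()

  2∤s : ¬ 2 ∣ s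
  2∤s = 2∤sb ∘ ∣m⇒∣m*n b

  2∤b : ¬ 2 ∣ b
  2∤b = 2∤sb ∘ ∣n⇒∣m*n s

  open SolutionParity a b c r s 2∤s 2∤b
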